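{- Let $m=2n+1\ge 5$ be odd and let $\varphi=(\mathcal A_1,\dots,\mathcal A_m)$ and $\varphi'=(\mathcal A'_1,\dots,\mathcal A'_m)$ be rings (as defined in the context), with indices taken modulo $m$. If $\varphi'=T_i(\varphi)$, then $|\mathcal A_i|\ge 2$, and either $|\mathcal A_{i+1}|+|\mathcal A_{i+2}|\le m-1$ or $|\mathcal A_{i-1}|+|\mathcal A_{i-2}|\le m-1$.
   Context: Indices are taken cyclically modulo $m$. A ring is a sequence $\varphi=(\mathcal A_1,\dots,\mathcal A_m)$ of pairwise disjoint finite vertex sets such that $|\mathcal A_i|\ge 1$ and $|\mathcal A_i|+|\mathcal A_{i+1}|\le m$ for all $i$, and $\sum_{i=1}^m|\mathcal A_i| = m\lfloor m/2\rfloor$. A ring $\varphi'=(\mathcal A'_1,\dots,\mathcal A'_m)$ is a transformation of a ring $\varphi=(\mathcal A_1,\dots,\mathcal A_m)$, written $\varphi'=T_i(\varphi)$, if there is a unique index $i$ such that $|\mathcal A'_i|=|\mathcal A_i|-1$ and either $|\mathcal A'_{i+1}|=|\mathcal A_{i+1}|+1$ or $|\mathcal A'_{i-1}|=|\mathcal A_{i-1}|+1$, all other cardinalities being unchanged (i.e. one vertex is moved from $\mathcal A_i$ to an adjacent set). -}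

module Defs where

open import Level using (Level)
open import Data.Nat using (ℕ; suc; _+_; _*_; _∸_; _≤_; NonZero)
open import Data.Nat.DivMod using (_/_; _%_; m%n<n)
open import Data.Fin using (Fin; toℕ; fromℕ<)
open import Data.List using (List; length; map; allFin)
open import Data.Nat.ListAction using (sum)
open import Data.List.Membership.Propositional using (_∈_)
open import Data.List.Relation.Unary.Unique.Propositional using (Unique)
open import Data.Product using (_×_)
open import Data.Sum using (_⊎_)
open import Relation.Binary.PropositionalEquality using (_≡_)
open import Relation.Nullary using (¬_)

cyc : (m : ℕ) .{{_ : NonZero m}} → ℕ → Fin m
cyc m k = fromℕ< (m%n<n k m)

nxt : {m : ℕ} .{{_ : NonZero m}} → Fin m → Fin m
nxt {m} i = cyc m (toℕ i + 1)

prv : {m : ℕ} .{{_ : NonZero m}} → Fin m → Fin m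
prv {m} i = cyc m (toℕ i + (m ∸ 1))

-- A ring: a sequence (A_1,…,A_m) (indexed by Fin m) of pairwise disjoint
-- finite vertex sets (duplicate-free lists over a vertex type V),
-- with |A_i| ≥ 1, |A_i| + |A_{i+1}| ≤ m and Σ |A_i| = m ⌊m/2⌋.
record Ring {ℓ : Level} (V : Set ℓ) (m : ℕ) .{{_ : NonZero m}} : Set ℓ where
  field
    A        : Fin m → List V
    unique   : ∀ i → Unique (A i)
    disjoint : ∀ i j (x : V) → x ∈ A i → x ∈ A j → i ≡ j
    nonempty : ∀ i → 1 ≤ length (A i)
    adjacent : ∀ i → length (A i) + length (A (nxt i)) ≤ m
    total    : sum (map (λ i → length (A i)) (allFin m)) ≡ m * (m / 2)

  size : Fin m → ℕ
  size i = length (A i)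

open Ring public

IsTransformation : {ℓ : Level} {V : Set ℓ} {m : ℕ} .{{_ : NonZero m}} →
                   Fin m → Ring V m → Ring V m → Set
IsTransformation {m = m} i φ φ' =
  size φ' i ≡ size φ i ∸ 1 ×
  ( (size φ' (nxt i) ≡ size φ (nxt i) + 1 ×
     (∀ j → ¬ j ≡ i → ¬ j ≡ nxt i → size φ' j ≡ size φ j))
  ⊎ (size φ' (prv i) ≡ size φ (prv i) + 1 ×
     (∀ j → ¬ j ≡ i → ¬ j ≡ prv i → size φ' j ≡ size φ j)))

-- Removing one vertex from A_i leaves A'_i nonempty, so |A_i| ≥ 2. If the
-- vertex goes to A_{i+1}, the pair (A'_{i+1}, A'_{i+2}) is the pair
-- (A_{i+1}, A_{i+2}) with one extra vertex, and since i+2 ∉ {i, i+1} for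
-- m ≥ 3 the ring condition |A'_{i+1}| + |A'_{i+2}| ≤ m gives the bound;
-- symmetrically for A_{i-1}.
module Submission where

open import Defs
open import Level using (Level)
open import Data.Nat using (ℕ; suc; _+_; _*_; _∸_; _≤_; _<_; NonZero; s≤s; s≤s⁻¹)
open import Data.Nat.Properties
  using (+-comm; +-assoc; +-suc; +-cancelˡ-≡; ≤-trans; <⇒≤; m≤m+n; n>0⇒n≢0; m∸n≢0⇒n<m)
open import Data.Nat.DivMod
  using (_%_; _/_; m≡m%n+[m/n]*n; %-distribˡ-+; m%n%n≡m%n; [m+n]%n≡m%n; m<n⇒m%n≡m)
open import Data.Nat.Divisibility using (_∣_; divides; >⇒∤)
open import Data.Fin using (Fin; toℕ)
open import Data.Fin.Properties using (toℕ-fromℕ<; toℕ-injective; toℕ<n)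
open import Data.Product using (_×_; _,_)
open import Data.Sum using (_⊎_; inj₁; inj₂)
open import Relation.Binary.PropositionalEquality
  using (_≡_; _≢_; refl; sym; trans; cong; cong₂; subst; module ≡-Reasoning)

[m%n+k]%n≡[m+k]%n : ∀ m k n .{{_ : NonZero n}} → (m % n + k) % n ≡ (m + k) % n
[m%n+k]%n≡[m+k]%n m k n = begin
  (m % n + k) % n             ≡⟨ %-distribˡ-+ (m % n) k n ⟩
  (m % n % n + k % n) % n     ≡⟨ cong (λ r → (r + k % n) % n) (m%n%n≡m%n m n) ⟩
  (m % n + k % n) % n         ≡⟨ %-distribˡ-+ m k n ⟨
  (m + k) % n                 ∎
  where open ≡-Reasoning

[m+k]%n≡m⇒n∣k : ∀ m k n .{{_ : NonZero n}} → (m + k) % n ≡ m → n ∣ k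
[m+k]%n≡m⇒n∣k m k n eq = divides ((m + k) / n) (+-cancelˡ-≡ m k _ (begin
  m + k                         ≡⟨ m≡m%n+[m/n]*n (m + k) n ⟩
  (m + k) % n + (m + k) / n * n ≡⟨ cong (_+ (m + k) / n * n) eq ⟩
  m + (m + k) / n * n           ∎))
  where open ≡-Reasoning

-- The cycle length is written suc k: then m ∸ 1 reduces to k and prv adds k.
module Cyclic {k : ℕ} where

  toℕ-nxt : (i : Fin (suc k)) → toℕ (nxt i) ≡ (toℕ i + 1) % suc k
  toℕ-nxt i = toℕ-fromℕ< _

  toℕ-nxt-nxt : (i : Fin (suc k)) → toℕ (nxt (nxt i)) ≡ (toℕ i + 2) % suc k
  toℕ-nxt-nxt i = begin
    toℕ (nxt (nxt i))                 ≡⟨ toℕ-nxt (nxt i) ⟩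
    (toℕ (nxt i) + 1) % suc k         ≡⟨ cong (λ r → (r + 1) % suc k) (toℕ-nxt i) ⟩
    ((toℕ i + 1) % suc k + 1) % suc k ≡⟨ [m%n+k]%n≡[m+k]%n (toℕ i + 1) 1 (suc k) ⟩
    (toℕ i + 1 + 1) % suc k           ≡⟨ cong (_% suc k) (+-assoc (toℕ i) 1 1) ⟩
    (toℕ i + 2) % suc k               ∎
    where open ≡-Reasoning

  toℕ-prv : (i : Fin (suc k)) → toℕ (prv i) ≡ (toℕ i + k) % suc k
  toℕ-prv i = toℕ-fromℕ< _

  nxt-prv : (i : Fin (suc k)) → nxt (prv i) ≡ i
  nxt-prv i = toℕ-injective (begin
    toℕ (nxt (prv i))                ≡⟨ toℕ-nxt (prv i) ⟩
    (toℕ (prv i) + 1) % suc k        ≡⟨ cong (λ r → (r + 1) % suc k) (toℕ-prv i) ⟩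
    ((toℕ i + k) % suc k + 1) % suc k ≡⟨ [m%n+k]%n≡[m+k]%n (toℕ i + k) 1 (suc k) ⟩
    (toℕ i + k + 1) % suc k          ≡⟨ cong (_% suc k) (+-assoc (toℕ i) k 1) ⟩
    (toℕ i + (k + 1)) % suc k        ≡⟨ cong (λ r → (toℕ i + r) % suc k) (+-comm k 1) ⟩
    (toℕ i + suc k) % suc k          ≡⟨ [m+n]%n≡m%n (toℕ i) (suc k) ⟩
    toℕ i % suc k                    ≡⟨ m<n⇒m%n≡m (toℕ<n i) ⟩
    toℕ i                            ∎)
    where open ≡-Reasoning

  shift-≢ : ∀ (i : Fin (suc k)) s .{{_ : NonZero s}} → s < suc k →
            (toℕ i + s) % suc k ≢ toℕ i
  shift-≢ i s s<m eq = >⇒∤ s<m ([m+k]%n≡m⇒n∣k (toℕ i) s (suc k) eq)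

  nxt-nxt≢ : 2 ≤ k → (i : Fin (suc k)) → nxt (nxt i) ≢ i
  nxt-nxt≢ 2≤k i eq =
    shift-≢ i 2 (s≤s 2≤k) (trans (sym (toℕ-nxt-nxt i)) (cong toℕ eq))

  nxt≢ : 1 ≤ k → (i : Fin (suc k)) → nxt i ≢ i
  nxt≢ 1≤k i eq = shift-≢ i 1 (s≤s 1≤k) (trans (sym (toℕ-nxt i)) (cong toℕ eq))

  prv≢ : 1 ≤ k → (i : Fin (suc k)) → prv i ≢ i
  prv≢ 1≤k i eq = nxt≢ 1≤k i (trans (cong nxt (sym eq)) (nxt-prv i))

  prv-prv≢ : 2 ≤ k → (i : Fin (suc k)) → prv (prv i) ≢ i
  prv-prv≢ 2≤k i eq = nxt-nxt≢ 2≤k i (begin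
    nxt (nxt i)               ≡⟨ cong (λ j → nxt (nxt j)) eq ⟨
    nxt (nxt (prv (prv i)))   ≡⟨ cong nxt (nxt-prv (prv i)) ⟩
    nxt (prv i)               ≡⟨ nxt-prv i ⟩
    i                         ∎)
    where open ≡-Reasoning

module Transformation {ℓ : Level} {V : Set ℓ} {k : ℕ} (φ φ' : Ring V (suc k)) where
  open Cyclic

  shrunk-size-≥2 : ∀ i → size φ' i ≡ size φ i ∸ 1 → 2 ≤ size φ i
  shrunk-size-≥2 i shrinks =
    m∸n≢0⇒n<m (n>0⇒n≢0 (subst (1 ≤_) shrinks (nonempty φ' i)))

  adjacent-before-gain : ∀ j j' → nxt j ≡ j' →
    size φ' j + size φ' j' ≡ suc (size φ j + size φ j') →
    size φ j + size φ j' ≤ k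
  adjacent-before-gain j _ refl gain = s≤s⁻¹ (subst (_≤ suc k) gain (adjacent φ' j))

  gain-forward : 2 ≤ k → ∀ i →
    size φ' (nxt i) ≡ size φ (nxt i) + 1 →
    (∀ j → j ≢ i → j ≢ nxt i → size φ' j ≡ size φ j) →
    size φ (nxt i) + size φ (nxt (nxt i)) ≤ k
  gain-forward 2≤k i gained unchanged = adjacent-before-gain (nxt i) _ refl (begin
    size φ' (nxt i) + size φ' (nxt (nxt i))
      ≡⟨ cong₂ _+_ gained (unchanged _ (nxt-nxt≢ 2≤k i) (nxt≢ (<⇒≤ 2≤k) (nxt i))) ⟩
    size φ (nxt i) + 1 + size φ (nxt (nxt i))
      ≡⟨ cong (_+ size φ (nxt (nxt i))) (+-comm (size φ (nxt i)) 1) ⟩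
    suc (size φ (nxt i) + size φ (nxt (nxt i)))  ∎)
    where open ≡-Reasoning

  gain-backward : 2 ≤ k → ∀ i →
    size φ' (prv i) ≡ size φ (prv i) + 1 →
    (∀ j → j ≢ i → j ≢ prv i → size φ' j ≡ size φ j) →
    size φ (prv i) + size φ (prv (prv i)) ≤ k
  gain-backward 2≤k i gained unchanged =
    subst (_≤ k) (+-comm (size φ (prv (prv i))) (size φ (prv i)))
      (adjacent-before-gain (prv (prv i)) (prv i) (nxt-prv (prv i)) (begin
        size φ' (prv (prv i)) + size φ' (prv i)
          ≡⟨ cong₂ _+_ (unchanged _ (prv-prv≢ 2≤k i) (prv≢ (<⇒≤ 2≤k) (prv i))) gained ⟩
        size φ (prv (prv i)) + (size φ (prv i) + 1)
          ≡⟨ cong (size φ (prv (prv i)) +_) (+-comm (size φ (prv i)) 1) ⟩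
        size φ (prv (prv i)) + suc (size φ (prv i))
          ≡⟨ +-suc (size φ (prv (prv i))) (size φ (prv i)) ⟩
        suc (size φ (prv (prv i)) + size φ (prv i))  ∎))
    where open ≡-Reasoning

  transformation-bounds : 2 ≤ k → ∀ i → IsTransformation i φ φ' →
    2 ≤ size φ i ×
    ( size φ (nxt i) + size φ (nxt (nxt i)) ≤ k
    ⊎ size φ (prv i) + size φ (prv (prv i)) ≤ k )
  transformation-bounds 2≤k i (shrinks , inj₁ (gained , unchanged)) =
    shrunk-size-≥2 i shrinks , inj₁ (gain-forward 2≤k i gained unchanged)
  transformation-bounds 2≤k i (shrinks , inj₂ (gained , unchanged)) =
    shrunk-size-≥2 i shrinks , inj₂ (gain-backward 2≤k i gained unchanged)

open Transformation using (transformation-bounds)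

lemma2p6 : {ℓ : Level} {V : Set ℓ} (n : ℕ) → 2 ≤ n →
           (φ φ' : Ring V (suc (2 * n))) (i : Fin (suc (2 * n))) →
           IsTransformation i φ φ' →
           2 ≤ size φ i ×
           ( size φ (nxt i) + size φ (nxt (nxt i)) ≤ suc (2 * n) ∸ 1
           ⊎ size φ (prv i) + size φ (prv (prv i)) ≤ suc (2 * n) ∸ 1 )
lemma2p6 n 2≤n φ φ' = transformation-bounds φ φ' (≤-trans 2≤n (m≤m+n n (n + 0)))
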